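{- Let $\Delta$ be a bi-transitive bipartite digraph. (i) Every $\dot{\sim}$-consistent underlying oriented digraph of $\Delta$ is acyclic. (ii) If $\Delta$ contains no two (distinct) equivalent vertices, then the only directed cycles of $\Delta$ have length $2$, and they are induced by symmetric edges.
   Context: Digraphs have no loops or multiple edges; $N(u)$, $N^-(u)$ denote out- and in-neighbourhoods. A bipartite digraph has two colour classes with every edge joining different classes; it is bi-transitive if whenever $u_1v_1,v_1u_2,u_2v_2$ are edges, $u_1v_2$ is an edge. Vertices $x,y$ are equivalent, written $x\dot{\sim}y$, if $N(x)=N(y)$ and $N^-(x)=N^-(y)$. A symmetric edge is a pair $u,v$ with both $uv$ and $vu$ edges. An underlying oriented digraph $\tilde\Delta$ of $\Delta$ has the same vertex set and is obtained by deleting, for every symmetric edge, exactly one of its two directed edges. It is $\dot{\sim}$-consistent if for all vertices $u\dot{\sim}u'$ and $v\dot{\sim}v'$: $uv$ is an edge of $\tilde\Delta$ iff $u'v'$ is an edge of $\tilde\Delta$. A directed cycle is a closed directed trail in which all vertices except the first and last are distinct; acyclic means there is no directed cycle. -}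

module Defs where

open import Data.Bool using (Bool)
open import Data.Nat using (ℕ; suc)
open import Data.Fin using (Fin; zero; suc; inject₁; fromℕ)
open import Data.Product using (Σ; _×_)
open import Data.Sum using (_⊎_)
open import Relation.Nullary using (¬_)
open import Relation.Binary.PropositionalEquality using (_≡_; _≢_)
open import Function.Definitions using (Injective)

-- A digraph on vertex type V is an edge relation E : V → V → Set
-- (at most one edge uv per ordered pair; loops excluded below).

Loopless : {V : Set} → (V → V → Set) → Set
Loopless {V} E = ∀ (u : V) → ¬ E u u

Bipartite : {V : Set} → (V → V → Set) → Set
Bipartite {V} E = Σ (V → Bool) λ c → ∀ {u v : V} → E u v → c u ≢ c v

BiTransitive : {V : Set} → (V → V → Set) → Set
BiTransitive {V} E =
  ∀ {u₁ v₁ u₂ v₂ : V} → E u₁ v₁ → E v₁ u₂ → E u₂ v₂ → E u₁ v₂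

_⇔_ : Set → Set → Set
A ⇔ B = (A → B) × (B → A)

Equiv : {V : Set} → (V → V → Set) → V → V → Set
Equiv {V} E x y = (∀ (z : V) → E x z ⇔ E y z) × (∀ (z : V) → E z x ⇔ E z y)

IsUnderlyingOriented : {V : Set} → (V → V → Set) → (V → V → Set) → Set
IsUnderlyingOriented {V} E E' =
    (∀ {u v : V} → E' u v → E u v)
  × (∀ {u v : V} → E u v → ¬ E v u → E' u v)
  × (∀ {u v : V} → E u v → E v u → E' u v ⊎ E' v u)
  × (∀ {u v : V} → E u v → E v u → ¬ (E' u v × E' v u))

Consistent : {V : Set} → (V → V → Set) → (V → V → Set) → Set
Consistent {V} E E' =
  ∀ {u u' v v' : V} → Equiv E u u' → Equiv E v v' → E' u v ⇔ E' u' v'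

-- A directed cycle of length suc n: distinct vertices f 0, …, f n with
-- edges f i → f (i+1) and f n → f 0.
IsDirectedCycle : {V : Set} → (V → V → Set) → (n : ℕ) → (Fin (suc n) → V) → Set
IsDirectedCycle E n f =
    Injective _≡_ _≡_ f
  × (∀ (i : Fin n) → E (f (inject₁ i)) (f (suc i)))
  × E (f (fromℕ n)) (f zero)

Acyclic : {V : Set} → (V → V → Set) → Set
Acyclic {V} E = ∀ (n : ℕ) (f : Fin (suc n) → V) → ¬ IsDirectedCycle E n f

-- In a bi-transitive digraph a walk u₁v₁u₂v₂ can be shortcut to the edge u₁v₂,
-- so every walk of positive length shrinks to one of length 1 or 2 with the
-- same endpoints.  On a directed cycle v₀v₁v₂…v₀ of length at least 3 this turns
-- the part from v₂ back to v₀ into either an edge v₂v₀, giving a loop at v₀, or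
-- a path v₂av₀; and the closed walk v₀v₁v₂av₀ forces v₀ ∼̇ v₂ by bi-transitivity.
-- Then (ii) follows from injectivity of the cycle, and (i) because consistency
-- moves the oriented edge v₀v₁ to v₂v₁, opposite to the oriented edge v₁v₂.
module Submission where

open import Defs
open import Data.Nat using (ℕ; suc; zero)
open import Data.Fin using (Fin; zero; suc; inject₁; fromℕ)
open import Data.Product using (_×_; _,_; ∃; proj₁)
open import Data.Sum using (_⊎_; inj₁; inj₂)
open import Data.Empty using (⊥-elim)
open import Relation.Nullary using (¬_)
open import Relation.Binary.PropositionalEquality using (_≡_; refl)

module _ {V : Set} (E : V → V → Set) where

  OneOrTwoSteps : V → V → Set
  OneOrTwoSteps x y = E x y ⊎ ∃ λ a → E x a × E a y

  Equiv-refl : ∀ x → Equiv E x x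
  Equiv-refl x = (λ _ → (λ e → e) , (λ e → e)) , (λ _ → (λ e → e) , (λ e → e))

  cycle-⊆ : ∀ {E' : V → V → Set} → (∀ {u v} → E' u v → E u v) →
    ∀ n f → IsDirectedCycle E' n f → IsDirectedCycle E n f
  cycle-⊆ E'⊆E n f (inj , step , close) = inj , (λ i → E'⊆E (step i)) , E'⊆E close

  no-cycle-of-length-one : Loopless E → ∀ f → ¬ IsDirectedCycle E zero f
  no-cycle-of-length-one loopless f (_ , _ , close) = loopless (f zero) close

  module _ (bt : BiTransitive E) where

    walk⇒oneOrTwoSteps : ∀ m (h : Fin (suc m) → V) {z} →
      (∀ i → E (h (inject₁ i)) (h (suc i))) →
      E (h (fromℕ m)) z → OneOrTwoSteps (h zero) z
    walk⇒oneOrTwoSteps zero h step last = inj₁ last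
    walk⇒oneOrTwoSteps (suc m) h step last
      with walk⇒oneOrTwoSteps m (λ i → h (suc i)) (λ i → step (suc i)) last
    ... | inj₁ e = inj₂ (h (suc zero) , step zero , e)
    ... | inj₂ (a , e₁ , e₂) = inj₁ (bt (step zero) e₁ e₂)

    closed-four-walk⇒Equiv : ∀ {v₀ v₁ v₂ a} →
      E v₀ v₁ → E v₁ v₂ → E v₂ a → E a v₀ → Equiv E v₀ v₂
    closed-four-walk⇒Equiv e₀₁ e₁₂ e₂ₐ eₐ₀ =
      (λ z → (λ e₀z → bt e₂ₐ eₐ₀ e₀z) , (λ e₂z → bt e₀₁ e₁₂ e₂z)) ,
      (λ z → (λ ez₀ → bt ez₀ e₀₁ e₁₂) , (λ ez₂ → bt ez₂ e₂ₐ eₐ₀))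

    long-cycle⇒Equiv : Loopless E → ∀ m f → IsDirectedCycle E (suc (suc m)) f →
      Equiv E (f zero) (f (suc (suc zero)))
    long-cycle⇒Equiv loopless m f (_ , step , close)
      with walk⇒oneOrTwoSteps m (λ i → f (suc (suc i))) (λ i → step (suc (suc i))) close
    ... | inj₁ e₂₀ = ⊥-elim (loopless (f zero) (bt (step zero) (step (suc zero)) e₂₀))
    ... | inj₂ (a , e₂ₐ , eₐ₀) = closed-four-walk⇒Equiv (step zero) (step (suc zero)) e₂ₐ eₐ₀

    consistent-oriented-acyclic : Loopless E → ∀ E' →
      IsUnderlyingOriented E E' → Consistent E E' → Acyclic E'
    consistent-oriented-acyclic loopless E' (E'⊆E , _ , _ , not-both) consistent = acyclic
      where
      acyclic : Acyclic E'
      acyclic zero f cycle = no-cycle-of-length-one loopless f (cycle-⊆ E'⊆E zero f cycle)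
      acyclic (suc zero) f (_ , step , close) =
        not-both (E'⊆E (step zero)) (E'⊆E close) (step zero , close)
      acyclic (suc (suc m)) f cycle@(_ , step , _) =
        not-both (E'⊆E (step (suc zero))) (E'⊆E e'₂₁) (step (suc zero) , e'₂₁)
        where
        v₀∼v₂ : Equiv E (f zero) (f (suc (suc zero)))
        v₀∼v₂ = long-cycle⇒Equiv loopless m f (cycle-⊆ E'⊆E (suc (suc m)) f cycle)

        e'₂₁ : E' (f (suc (suc zero))) (f (suc zero))
        e'₂₁ = proj₁ (consistent v₀∼v₂ (Equiv-refl (f (suc zero)))) (step zero)

    twin-free-cycle-length : Loopless E → (∀ x y → Equiv E x y → x ≡ y) →
      ∀ n f → IsDirectedCycle E n f → suc n ≡ 2
    twin-free-cycle-length loopless twin-free zero f cycle =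
      ⊥-elim (no-cycle-of-length-one loopless f cycle)
    twin-free-cycle-length loopless twin-free (suc zero) f cycle = refl
    twin-free-cycle-length loopless twin-free (suc (suc m)) f cycle@(inj , _ , _)
      with inj (twin-free _ _ (long-cycle⇒Equiv loopless m f cycle))
    ... | ()

corollary1 : {V : Set} (E : V → V → Set) →
    Loopless E → Bipartite E → BiTransitive E →
    ((E' : V → V → Set) → IsUnderlyingOriented E E' → Consistent E E' → Acyclic E')
    × ((∀ (x y : V) → Equiv E x y → x ≡ y) →
    ∀ (n : ℕ) (f : Fin (suc n) → V) → IsDirectedCycle E n f →
    suc n ≡ 2)
corollary1 E loopless _ bt =
  consistent-oriented-acyclic E bt loopless ,
  λ twin-free → twin-free-cycle-length E bt loopless twin-free
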